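{- Let $d$ be a square-free integer with $d < 0$. Among all algebraic integers $\alpha$ with $\mathbf{Q}(\alpha) = \mathbf{Q}(\sqrt{d})$, those of smallest height have minimal polynomial $x^2 - d$ if $d \equiv 2, 3 \pmod 4$, and $x^2 \pm x + \frac{1-d}{4}$ if $d \equiv 1 \pmod 4$.
   Context: For an algebraic number $\alpha$ with minimal polynomial $f = a_n x^n + \dots + a_0$ over $\mathbf{Q}$ normalized so that $a_i \in \mathbf{Z}$ and $\gcd(a_0,\dots,a_n)=1$, the height is $H(\alpha) = \max(|a_0|,\dots,|a_n|)$. -}

module Defs where

open import Data.Nat using (ℕ)
open import Data.Integer as ℤ using (ℤ; +_)
import Data.Integer.Divisibility as ℤD
open import Data.Nat.Divisibility as ℕD using ()
open import Data.Rational as ℚ using (ℚ; 0ℚ; 1ℚ; ½; _/_; ∣_∣; _⊔_)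
open import Data.List using (List; _∷_; []; foldr; map)
open import Data.List.Relation.Unary.All using (All)
open import Data.Product using (∃)
open import Relation.Binary.PropositionalEquality using (_≡_; _≢_)

SquareFree : ℤ → Set
SquareFree d = ∀ (k : ℕ) → (k Data.Nat.* k) ℕD.∣ ℤ.∣ d ∣ → k ≡ 1

ι : ℤ → ℚ
ι z = z / 1

-- An element p + q·√d of the field Q(√d) (for a fixed d, embedded in ℂ).
record QSqrt : Set where
  constructor _+_√d
  field
    re : ℚ
    im : ℚ
open QSqrt public

-- Q(α) = Q(√d) for α ∈ Q(√d) (d square-free, d ≠ 1) iff α ∉ Q, i.e. im α ≠ 0.
Generates : QSqrt → Set
Generates α = im α ≢ 0ℚ

-- Polynomials over Q as coefficient lists, constant term first.
Poly : Set
Poly = List ℚ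

-- Minimal polynomial over Q of α = p + q√d with q ≠ 0 (d square-free, d ≠ 1):
--   x² − 2p·x + (p² − d q²)
minPoly : ℤ → QSqrt → Poly
minPoly d α =
  (p ℚ.* p ℚ.- ι d ℚ.* q ℚ.* q) ∷ ℚ.- (ι (+ 2) ℚ.* p) ∷ 1ℚ ∷ []
  where
  p = re α
  q = im α

IsIntegral : ℚ → Set
IsIntegral c = ∃ λ (z : ℤ) → c ≡ ι z

IsAlgInt : ℤ → QSqrt → Set
IsAlgInt d α = All IsIntegral (minPoly d α)

-- For a monic integer polynomial (the case of algebraic integers) this is
-- exactly H as normalized in the paper (gcd of coefficients is 1).
polyHeight : Poly → ℚ
polyHeight f = foldr _⊔_ 0ℚ (map ∣_∣ f)

height : ℤ → QSqrt → ℚ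
height d α = polyHeight (minPoly d α)

x²-d : ℤ → Poly
x²-d d = ℚ.- ι d ∷ 0ℚ ∷ 1ℚ ∷ []

x²+sx+[1-d]/4 : ℚ → ℤ → Poly
x²+sx+[1-d]/4 s d = (1ℚ ℚ.- ι d) ℚ.* ½ ℚ.* ½ ∷ s ∷ 1ℚ ∷ []

{-# OPTIONS --safe #-}
-- An irrational algebraic integer α = p + q√d of Q(√d) has minimal polynomial
-- x² + c₁x + c₀ with c₁, c₀ ∈ Z, whose discriminant c₁² − 4c₀ = d(2q)² is an integer;
-- since d is square-free this forces f = 2q ∈ Z, f ≠ 0.  For d = −D < 0 we get
-- 4c₀ = c₁² + D f², and the height of α is at least its norm c₀.  The candidates √d
-- and (1 + √d)/2 have heights D and (1 + D)/4, so a minimal α has c₀ ≤ D, resp.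
-- c₀ ≤ (1 + D)/4; size and residues mod 4 in 4c₀ = c₁² + D f² then leave only
-- c₁ = 0, c₀ = D, resp. c₁ = ±1, c₀ = (1 + D)/4.
module Submission where

open import Defs
open import Data.Integer as ℤ using (ℤ; +_; _<_; _-_)
open import Data.Integer.Divisibility using (_∣_)
open import Data.Rational as ℚ using (1ℚ)
open import Data.Sum using (_⊎_)
open import Data.Product using (_×_)
open import Relation.Binary.PropositionalEquality using (_≡_)

open import Data.Nat as ℕ using (ℕ; zero; suc; _+_; _*_; _≤_; z≤n; s≤s; NonZero)
import Data.Nat.Properties as ℕP
open import Data.Nat.Divisibility as ℕD using (divides; ∣m+n∣m⇒∣n)
  renaming (_∣_ to _∣ₙ_; _∣?_ to _∣ₙ?_)
open import Data.Nat.Coprimality as C using (Coprime)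
open import Data.Nat.Tactic.RingSolver using () renaming (solve-∀ to ℕ-solve-∀)
open import Data.Integer using (-[1+_]; +[1+_])
import Data.Integer.Properties as ℤP
open import Data.Integer.Tactic.RingSolver using () renaming (solve-∀ to ℤ-solve-∀)
open import Data.Rational using (mkℚ; 0ℚ; ½)
import Data.Rational.Properties as ℚP
import Data.Rational.Unnormalised as ℚᵘ
import Data.Rational.Unnormalised.Properties as ℚᵘP
open import Data.Rational.Solver using (module +-*-Solver)
open +-*-Solver using (solve; _:=_; _:*_; _:-_; :-_; con)
open import Data.List using (_∷_; [])
open import Data.List.Relation.Unary.All using (All; _∷_; [])
open import Data.Product using (∃-syntax; _,_; proj₁; proj₂)
open import Data.Sum using (inj₁; inj₂; reduce)
import Data.Sum as Sum
open import Data.Empty using (⊥-elim)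
open import Function using (_∘_)
open import Relation.Nullary using (¬_)
open import Relation.Nullary.Decidable using (from-no)
open import Relation.Binary.PropositionalEquality
  using (_≢_; refl; sym; trans; cong; cong₂; subst; subst₂; module ≡-Reasoning)

ι≡mkℚ : ∀ z → ι z ≡ mkℚ z 0 (C.sym (C.1-coprimeTo ℤ.∣ z ∣))
ι≡mkℚ (+ n)    = ℚP.normalize-coprime (C.sym (C.1-coprimeTo n))
ι≡mkℚ -[1+ n ] = cong ℚ.-_ (ℚP.normalize-coprime (C.sym (C.1-coprimeTo (suc n))))

ι-* : ∀ x y → ι (x ℤ.* y) ≡ ι x ℚ.* ι y
ι-* x y = sym (cong₂ ℚ._*_ (ι≡mkℚ x) (ι≡mkℚ y))

ι-+ : ∀ x y → ι (x ℤ.+ y) ≡ ι x ℚ.+ ι y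
ι-+ x y = trans (cong ι (sym (cong₂ ℤ._+_ (ℤP.*-identityʳ x) (ℤP.*-identityʳ y))))
                (sym (cong₂ ℚ._+_ (ι≡mkℚ x) (ι≡mkℚ y)))

ι-neg : ∀ z → ι (ℤ.- z) ≡ ℚ.- ι z
ι-neg (+ zero)   = refl
ι-neg +[1+ n ]   = refl
ι-neg -[1+ n ]   = sym (solve 1 (λ x → :- (:- x) := x) refl (ι +[1+ n ]))

ι-- : ∀ x y → ι (x - y) ≡ ι x ℚ.- ι y
ι-- x y = trans (ι-+ x (ℤ.- y)) (cong (ι x ℚ.+_) (ι-neg y))

ι-injective : ∀ {x y} → ι x ≡ ι y → x ≡ y
ι-injective {x} {y} ιx≡ιy = cong ℚ.↥_ (trans (sym (ι≡mkℚ x)) (trans ιx≡ιy (ι≡mkℚ y)))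

ι-mono-≤ : ∀ {x y} → x ℤ.≤ y → ι x ℚ.≤ ι y
ι-mono-≤ {x} {y} x≤y = subst₂ ℚ._≤_ (sym (ι≡mkℚ x)) (sym (ι≡mkℚ y))
  (ℚ.*≤* (subst₂ ℤ._≤_ (sym (ℤP.*-identityʳ x)) (sym (ℤP.*-identityʳ y)) x≤y))

ι-cancel-≤ : ∀ {x y} → ι x ℚ.≤ ι y → x ℤ.≤ y
ι-cancel-≤ {x} {y} ιx≤ιy = subst₂ ℤ._≤_ (ℤP.*-identityʳ x) (ℤP.*-identityʳ y)
  (ℚP.drop-*≤* (subst₂ ℚ._≤_ (ι≡mkℚ x) (ι≡mkℚ y) ιx≤ιy))

∣ι+n∣≡ι+n : ∀ n → ℚ.∣ ι (+ n) ∣ ≡ ι (+ n)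
∣ι+n∣≡ι+n n = trans (cong ℚ.∣_∣ (ι≡mkℚ (+ n))) (sym (ι≡mkℚ (+ n)))

*-ι↧≡ι↥ : ∀ r → r ℚ.* ι (ℚ.↧ r) ≡ ι (ℚ.↥ r)
*-ι↧≡ι↥ r@(mkℚ m n-1 _) rewrite ι≡mkℚ (+ suc n-1) | ι≡mkℚ m =
  ℚP.toℚᵘ-injective (ℚᵘP.≃-trans (ℚP.toℚᵘ-homo-* r n) (ℚᵘ.*≡* cross))
  where
  n = mkℚ (+ suc n-1) 0 (C.sym (C.1-coprimeTo (suc n-1)))
  cross : m ℤ.* + suc n-1 ℤ.* + 1 ≡ m ℤ.* + suc (n-1 ℕ.* 1)
  cross = trans (ℤP.*-identityʳ _) (cong (λ k → m ℤ.* + suc k) (sym (ℕP.*-identityʳ n-1)))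

coprime-*ʳ : ∀ {m n o} → Coprime m n → Coprime m o → Coprime m (n * o)
coprime-*ʳ {m} {n} m⊥n m⊥o {i} (i∣m , i∣n*o) = m⊥o (i∣m , C.coprime-divisor i⊥n i∣n*o)
  where
  i⊥n : Coprime i n
  i⊥n (j∣i , j∣n) = m⊥n (ℕD.∣-trans j∣i i∣m , j∣n)

coprime-square : ∀ {m n} → Coprime m n → Coprime (m * m) (n * n)
coprime-square {m} {n} m⊥n = C.sym (coprime-*ʳ n²⊥m n²⊥m)
  where
  n²⊥m : Coprime (n * n) m
  n²⊥m = C.sym (coprime-*ʳ m⊥n m⊥n)

squareFree⇒integral : ∀ {d z} → SquareFree d → ∀ r → ι d ℚ.* r ℚ.* r ≡ ι z → r ≡ ι (ℚ.↥ r)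
squareFree⇒integral {d} {z} sf r@(mkℚ _ _ m⊥n) dr²≡z = begin
  r                   ≡⟨ sym (ℚP.*-identityʳ r) ⟩
  r ℚ.* ι (+ 1)       ≡⟨ cong (λ k → r ℚ.* ι (+ k)) (sym n≡1) ⟩
  r ℚ.* ι (ℚ.↧ r)     ≡⟨ *-ι↧≡ι↥ r ⟩
  ι (ℚ.↥ r)           ∎
  where
  open ≡-Reasoning
  m = ℚ.↥ r
  n = ℚ.↧ₙ r
  cleared : z ℤ.* (+ n ℤ.* + n) ≡ m ℤ.* m ℤ.* d
  cleared = ι-injective (begin
    ι (z ℤ.* (+ n ℤ.* + n))                       ≡⟨ trans (ι-* z _) (cong (ι z ℚ.*_) (ι-* (+ n) (+ n))) ⟩
    ι z ℚ.* (ι (+ n) ℚ.* ι (+ n))                 ≡⟨ cong (ℚ._* (ι (+ n) ℚ.* ι (+ n))) (sym dr²≡z) ⟩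
    ι d ℚ.* r ℚ.* r ℚ.* (ι (+ n) ℚ.* ι (+ n))     ≡⟨ regroup (ι d) r (ι (+ n)) ⟩
    (r ℚ.* ι (+ n)) ℚ.* (r ℚ.* ι (+ n)) ℚ.* ι d   ≡⟨ cong (λ x → x ℚ.* x ℚ.* ι d) (*-ι↧≡ι↥ r) ⟩
    ι m ℚ.* ι m ℚ.* ι d                           ≡⟨ sym (trans (ι-* (m ℤ.* m) d) (cong (ℚ._* ι d) (ι-* m m))) ⟩
    ι (m ℤ.* m ℤ.* d)                             ∎)
    where
    regroup : ∀ δ r ν → δ ℚ.* r ℚ.* r ℚ.* (ν ℚ.* ν) ≡ (r ℚ.* ν) ℚ.* (r ℚ.* ν) ℚ.* δ
    regroup = solve 3 (λ δ r ν → δ :* r :* r :* (ν :* ν) := (r :* ν) :* (r :* ν) :* δ) refl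
  n²∣m²d : n * n ∣ₙ ℤ.∣ m ∣ * ℤ.∣ m ∣ * ℤ.∣ d ∣
  n²∣m²d = divides ℤ.∣ z ∣ (begin
    ℤ.∣ m ∣ * ℤ.∣ m ∣ * ℤ.∣ d ∣       ≡⟨ sym (trans (ℤP.abs-* (m ℤ.* m) d) (cong (_* ℤ.∣ d ∣) (ℤP.abs-* m m))) ⟩
    ℤ.∣ m ℤ.* m ℤ.* d ∣               ≡⟨ cong ℤ.∣_∣ (sym cleared) ⟩
    ℤ.∣ z ℤ.* (+ n ℤ.* + n) ∣         ≡⟨ trans (ℤP.abs-* z _) (cong (ℤ.∣ z ∣ *_) (ℤP.abs-* (+ n) (+ n))) ⟩
    ℤ.∣ z ∣ * (n * n)                 ∎)
  n≡1 : n ≡ 1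
  n≡1 = sf n (C.coprime-divisor (coprime-square (C.sym (C.recompute m⊥n))) n²∣m²d)

monicQuadratic : ℤ → ℤ → Poly
monicQuadratic c₀ c₁ = ι c₀ ∷ ι c₁ ∷ 1ℚ ∷ []

monicQuadratic-integral : ∀ {d β c₀ c₁} → minPoly d β ≡ monicQuadratic c₀ c₁ → IsAlgInt d β
monicQuadratic-integral {c₀ = c₀} {c₁} minPoly≡ =
  subst (All IsIntegral) (sym minPoly≡) ((c₀ , refl) ∷ (c₁ , refl) ∷ (+ 1 , refl) ∷ [])

-- α = (- c₁ + f √d) / 2, with norm c₀ and trace - c₁.
record IntegralForm (d : ℤ) (α : QSqrt) : Set where
  constructor integralForm
  field
    c₀ c₁ f      : ℤ
    minPoly≡     : minPoly d α ≡ monicQuadratic c₀ c₁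
    f≢0          : f ≢ + 0
    discriminant : d ℤ.* f ℤ.* f ≡ c₁ ℤ.* c₁ - + 4 ℤ.* c₀

algInt⇒integralForm : ∀ {d α} → SquareFree d → IsAlgInt d α → Generates α → IntegralForm d α
algInt⇒integralForm {d} {p + q √d} sf ((c₀ , c₀≡) ∷ (c₁ , c₁≡) ∷ _ ∷ []) q≢0 =
  integralForm c₀ c₁ f (cong₂ _∷_ c₀≡ (cong₂ _∷_ c₁≡ refl)) f≢0 (ι-injective (begin
    ι (d ℤ.* f ℤ.* f)          ≡⟨ trans (ι-* (d ℤ.* f) f) (cong (ℚ._* ι f) (ι-* d f)) ⟩
    ι d ℚ.* ι f ℚ.* ι f        ≡⟨ cong (λ x → ι d ℚ.* x ℚ.* x) (sym r≡f) ⟩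
    ι d ℚ.* r ℚ.* r            ≡⟨ dr²≡disc ⟩
    ι (c₁ ℤ.* c₁ - + 4 ℤ.* c₀) ∎))
  where
  open ≡-Reasoning
  r = ι (+ 2) ℚ.* q
  f = ℚ.↥ r
  dr²≡disc : ι d ℚ.* r ℚ.* r ≡ ι (c₁ ℤ.* c₁ - + 4 ℤ.* c₀)
  dr²≡disc = begin
    ι d ℚ.* r ℚ.* r
      ≡⟨ discriminant-identity p q (ι d) ⟩
    ℚ.- (ι (+ 2) ℚ.* p) ℚ.* ℚ.- (ι (+ 2) ℚ.* p) ℚ.- ι (+ 4) ℚ.* (p ℚ.* p ℚ.- ι d ℚ.* q ℚ.* q)
      ≡⟨ cong₂ (λ x y → x ℚ.* x ℚ.- ι (+ 4) ℚ.* y) c₁≡ c₀≡ ⟩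
    ι c₁ ℚ.* ι c₁ ℚ.- ι (+ 4) ℚ.* ι c₀
      ≡⟨ sym (trans (ι-- (c₁ ℤ.* c₁) (+ 4 ℤ.* c₀)) (cong₂ ℚ._-_ (ι-* c₁ c₁) (ι-* (+ 4) c₀))) ⟩
    ι (c₁ ℤ.* c₁ - + 4 ℤ.* c₀) ∎
    where
    discriminant-identity : ∀ p q δ → δ ℚ.* (ι (+ 2) ℚ.* q) ℚ.* (ι (+ 2) ℚ.* q) ≡
      ℚ.- (ι (+ 2) ℚ.* p) ℚ.* ℚ.- (ι (+ 2) ℚ.* p) ℚ.- ι (+ 4) ℚ.* (p ℚ.* p ℚ.- δ ℚ.* q ℚ.* q)
    discriminant-identity = solve 3 (λ p q δ → δ :* (con (ι (+ 2)) :* q) :* (con (ι (+ 2)) :* q) :=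
      :- (con (ι (+ 2)) :* p) :* :- (con (ι (+ 2)) :* p) :- con (ι (+ 4)) :* (p :* p :- δ :* q :* q)) refl
  r≡f : r ≡ ι f
  r≡f = squareFree⇒integral {d} {c₁ ℤ.* c₁ - + 4 ℤ.* c₀} sf r dr²≡disc
  f≢0 : f ≢ + 0
  f≢0 f≡0 = q≢0 (begin
    q               ≡⟨ solve 1 (λ q → q := con ½ :* (con (ι (+ 2)) :* q)) refl q ⟩
    ½ ℚ.* r         ≡⟨ cong (½ ℚ.*_) (trans r≡f (cong ι f≡0)) ⟩
    ½ ℚ.* ι (+ 0)   ≡⟨⟩
    0ℚ              ∎)

i*i≡+∣i∣*∣i∣ : ∀ i → i ℤ.* i ≡ + (ℤ.∣ i ∣ * ℤ.∣ i ∣)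
i*i≡+∣i∣*∣i∣ (+ n)    = sym (ℤP.pos-* n n)
i*i≡+∣i∣*∣i∣ -[1+ n ] = refl

norm-equation : ∀ {e c₀ c₁ f} → -[1+ e ] ℤ.* f ℤ.* f ≡ c₁ ℤ.* c₁ - + 4 ℤ.* c₀ →
  ∃[ Z ] c₀ ≡ + Z × ℤ.∣ c₁ ∣ * ℤ.∣ c₁ ∣ + suc e * (ℤ.∣ f ∣ * ℤ.∣ f ∣) ≡ 4 * Z
norm-equation {e} {c₀} {c₁} {f} disc = nonNegative c₀ 4c₀≡N
  where
  open ≡-Reasoning
  a = ℤ.∣ c₁ ∣
  g = ℤ.∣ f ∣
  N = a * a + suc e * (g * g)
  4c₀≡N : + 4 ℤ.* c₀ ≡ + N
  4c₀≡N = begin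
    + 4 ℤ.* c₀                                  ≡⟨ isolate (c₁ ℤ.* c₁) c₀ ⟩
    c₁ ℤ.* c₁ - (c₁ ℤ.* c₁ - + 4 ℤ.* c₀)        ≡⟨ cong (c₁ ℤ.* c₁ -_) (sym disc) ⟩
    c₁ ℤ.* c₁ - ℤ.- + suc e ℤ.* f ℤ.* f         ≡⟨ flip (c₁ ℤ.* c₁) (+ suc e) f ⟩
    c₁ ℤ.* c₁ ℤ.+ + suc e ℤ.* (f ℤ.* f)          ≡⟨ cong₂ (λ x y → x ℤ.+ + suc e ℤ.* y) (i*i≡+∣i∣*∣i∣ c₁) (i*i≡+∣i∣*∣i∣ f) ⟩
    + (a * a) ℤ.+ + suc e ℤ.* + (g * g)         ≡⟨ cong (λ x → + (a * a) ℤ.+ x) (sym (ℤP.pos-* (suc e) (g * g))) ⟩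
    + (a * a) ℤ.+ + (suc e * (g * g))           ≡⟨ sym (ℤP.pos-+ (a * a) _) ⟩
    + N                                         ∎
    where
    isolate : ∀ x c → + 4 ℤ.* c ≡ x - (x - + 4 ℤ.* c)
    isolate = ℤ-solve-∀
    flip : ∀ x D f → x - ℤ.- D ℤ.* f ℤ.* f ≡ x ℤ.+ D ℤ.* (f ℤ.* f)
    flip = ℤ-solve-∀
  nonNegative : ∀ c → + 4 ℤ.* c ≡ + N → ∃[ Z ] c ≡ + Z × N ≡ 4 * Z
  nonNegative (+ Z)     4Z≡N = Z , refl , sym (ℤP.+-injective (trans (ℤP.pos-* 4 Z) 4Z≡N))
  nonNegative -[1+ _ ] ()

∣-[1+m]-+[1+n]∣ : ∀ m n → ℤ.∣ -[1+ m ] - + suc n ∣ ≡ suc n + suc m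
∣-[1+m]-+[1+n]∣ m n = cong suc (trans (cong suc (ℕP.+-comm m n)) (sym (ℕP.+-suc n m)))

∣i∣≡1⇒i≡±1 : ∀ {i} → ℤ.∣ i ∣ ≡ 1 → i ≡ + 1 ⊎ i ≡ -[1+ 0 ]
∣i∣≡1⇒i≡±1 {+[1+ 0 ]}  _ = inj₁ refl
∣i∣≡1⇒i≡±1 { -[1+ 0 ]} _ = inj₂ refl

∣m+n∣n⇒∣m : ∀ {d} m {n} → d ∣ₙ m + n → d ∣ₙ n → d ∣ₙ m
∣m+n∣n⇒∣m {d} m {n} d∣m+n d∣n = ∣m+n∣m⇒∣n (subst (d ∣ₙ_) (ℕP.+-comm m n) d∣m+n) d∣n

4∣a²+n⇒4∣n⊎4∣1+n : ∀ a {n} → 4 ∣ₙ a * a + n → 4 ∣ₙ n ⊎ 4 ∣ₙ 1 + n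
4∣a²+n⇒4∣n⊎4∣1+n zero          h = inj₁ h
4∣a²+n⇒4∣n⊎4∣1+n (suc zero)    h = inj₂ h
4∣a²+n⇒4∣n⊎4∣1+n (suc (suc a)) {n} h =
  4∣a²+n⇒4∣n⊎4∣1+n a (∣m+n∣m⇒∣n (subst (4 ∣ₙ_) (expand a n) h) (ℕD.m∣m*n (1 + a)))
  where
  expand : ∀ a n → suc (suc a) * suc (suc a) + n ≡ 4 * (1 + a) + (a * a + n)
  expand = ℕ-solve-∀

¬4∣a²+n : ∀ a {n} → 4 ∣ₙ 2 + n ⊎ 4 ∣ₙ 3 + n → ¬ 4 ∣ₙ a * a + n
¬4∣a²+n a n≡2,3 h with 4∣a²+n⇒4∣n⊎4∣1+n a h | n≡2,3
... | inj₁ 4∣n   | inj₁ 4∣2+n = from-no (4 ∣ₙ? 2) (∣m+n∣n⇒∣m 2 4∣2+n 4∣n)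
... | inj₁ 4∣n   | inj₂ 4∣3+n = from-no (4 ∣ₙ? 3) (∣m+n∣n⇒∣m 3 4∣3+n 4∣n)
... | inj₂ 4∣1+n | inj₁ 4∣2+n = from-no (4 ∣ₙ? 1) (∣m+n∣n⇒∣m 1 4∣2+n 4∣1+n)
... | inj₂ 4∣1+n | inj₂ 4∣3+n = from-no (4 ∣ₙ? 2) (∣m+n∣n⇒∣m 2 4∣3+n 4∣1+n)

2≤f⇒a²+4D≤4Z : ∀ {a D f Z} → 2 ≤ f → a * a + D * (f * f) ≡ 4 * Z → a * a + 4 * D ≤ 4 * Z
2≤f⇒a²+4D≤4Z {a} {D} {f} {Z} 2≤f eq = begin
  a * a + 4 * D        ≡⟨ cong (λ x → a * a + x) (ℕP.*-comm 4 D) ⟩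
  a * a + D * 4        ≤⟨ ℕP.+-monoʳ-≤ (a * a) (ℕP.*-monoʳ-≤ D (ℕP.*-mono-≤ 2≤f 2≤f)) ⟩
  a * a + D * (f * f)  ≡⟨ eq ⟩
  4 * Z                ∎
  where open ℕP.≤-Reasoning

Z≤D⇒a≡0∧Z≡D : ∀ {a D f Z} → a * a + D * (f * f) ≡ 4 * Z → f ≢ 0 →
  4 ∣ₙ 2 + D ⊎ 4 ∣ₙ 3 + D → Z ≤ D → a ≡ 0 × Z ≡ D
Z≤D⇒a≡0∧Z≡D {f = zero} _ f≢0 _ _ = ⊥-elim (f≢0 refl)
Z≤D⇒a≡0∧Z≡D {a} {D} {f = suc zero} {Z} eq _ D≡2,3 _ =
  ⊥-elim (¬4∣a²+n a D≡2,3 (divides Z (trans eq' (ℕP.*-comm 4 Z))))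
  where
  eq' : a * a + D ≡ 4 * Z
  eq' = trans (cong (λ x → a * a + x) (sym (ℕP.*-identityʳ D))) eq
Z≤D⇒a≡0∧Z≡D {a} {D} {f = suc (suc f)} {Z} eq _ _ Z≤D =
  reduce (ℕP.m*n≡0⇒m≡0∨n≡0 a a²≡0) , ℕP.≤-antisym Z≤D D≤Z
  where
  a²+4D≤4Z : a * a + 4 * D ≤ 4 * Z
  a²+4D≤4Z = 2≤f⇒a²+4D≤4Z {a} {D} {suc (suc f)} {Z} (s≤s (s≤s z≤n)) eq
  a²≡0 : a * a ≡ 0
  a²≡0 = ℕP.n≤0⇒n≡0 (ℕP.+-cancelʳ-≤ (4 * D) (a * a) 0
           (ℕP.≤-trans a²+4D≤4Z (ℕP.*-monoʳ-≤ 4 Z≤D)))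
  D≤Z : D ≤ Z
  D≤Z = ℕP.*-cancelˡ-≤ 4 (ℕP.m+n≤o⇒n≤o (a * a) a²+4D≤4Z)

Z≤T⇒a≡1∧Z≡T : ∀ {a D f Z T} .{{_ : NonZero D}} → a * a + D * (f * f) ≡ 4 * Z → f ≢ 0 →
  1 + D ≡ 4 * T → Z ≤ T → a ≡ 1 × Z ≡ T
Z≤T⇒a≡1∧Z≡T {f = zero} _ f≢0 _ _ = ⊥-elim (f≢0 refl)
Z≤T⇒a≡1∧Z≡T {a} {D} {f = suc zero} {Z} {T} eq _ 1+D≡4T Z≤T = small a eq' a²≤1
  where
  eq' : a * a + D ≡ 4 * Z
  eq' = trans (cong (λ x → a * a + x) (sym (ℕP.*-identityʳ D))) eq
  4Z≤1+D : 4 * Z ≤ 1 + D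
  4Z≤1+D = subst (4 * Z ≤_) (sym 1+D≡4T) (ℕP.*-monoʳ-≤ 4 Z≤T)
  a²≤1 : a * a ≤ 1
  a²≤1 = ℕP.+-cancelʳ-≤ D (a * a) 1 (subst (_≤ 1 + D) (sym eq') 4Z≤1+D)
  small : ∀ a → a * a + D ≡ 4 * Z → a * a ≤ 1 → a ≡ 1 × Z ≡ T
  small zero          D≡4Z _ = ⊥-elim (from-no (4 ∣ₙ? 1)
    (∣m+n∣n⇒∣m 1 (divides T (trans 1+D≡4T (ℕP.*-comm 4 T)))
                 (divides Z (trans D≡4Z (ℕP.*-comm 4 Z)))))
  small (suc zero)    1+D≡4Z _ = refl , ℕP.*-cancelˡ-≡ Z T 4 (trans (sym 1+D≡4Z) 1+D≡4T)
  small (suc (suc _)) _ (s≤s ())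
Z≤T⇒a≡1∧Z≡T {a} {D} {f = suc (suc f)} {Z} eq _ 1+D≡4T Z≤T =
  ⊥-elim (from-no (3 ℕ.≤? 1) (ℕP.≤-trans (ℕP.*-monoʳ-≤ 3 (ℕ.>-nonZero⁻¹ D)) 3D≤1))
  where
  4D≤1+D : 4 * D ≤ 1 + D
  4D≤1+D = ℕP.≤-trans (ℕP.m+n≤o⇒n≤o (a * a) (2≤f⇒a²+4D≤4Z {a} {D} {suc (suc f)} {Z} (s≤s (s≤s z≤n)) eq))
             (subst (4 * Z ≤_) (sym 1+D≡4T) (ℕP.*-monoʳ-≤ 4 Z≤T))
  split : ∀ D → 4 * D ≡ D + 3 * D
  split = ℕ-solve-∀
  3D≤1 : 3 * D ≤ 1
  3D≤1 = ℕP.+-cancelˡ-≤ D (3 * D) 1 (subst₂ _≤_ (split D) (ℕP.+-comm 1 D) 4D≤1+D)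

polyHeight-monicQuadratic : ∀ c₀ c₁ → 1ℚ ℚ.≤ ℚ.∣ c₀ ∣ → ℚ.∣ c₁ ∣ ℚ.≤ 1ℚ →
  polyHeight (c₀ ∷ c₁ ∷ 1ℚ ∷ []) ≡ ℚ.∣ c₀ ∣
polyHeight-monicQuadratic c₀ c₁ 1≤∣c₀∣ ∣c₁∣≤1 =
  trans (cong (ℚ.∣ c₀ ∣ ℚ.⊔_) (ℚP.p≤q⇒p⊔q≡q ∣c₁∣≤1)) (ℚP.p≥q⇒p⊔q≡p 1≤∣c₀∣)

minimal⇒norm≤ : ∀ {d α} → (∀ β → IsAlgInt d β → Generates β → height d α ℚ.≤ height d β) →
  ∀ {Z c₁} → minPoly d α ≡ monicQuadratic (+ Z) c₁ →
  ∀ β H .{{_ : NonZero H}} s → Generates β → minPoly d β ≡ monicQuadratic (+ H) s →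
  ℚ.∣ ι s ∣ ℚ.≤ 1ℚ → Z ≤ H
minimal⇒norm≤ {d} {α} minimal {Z} {c₁} minPolyα≡ β H s genβ minPolyβ≡ ∣s∣≤1 =
  ℤP.drop‿+≤+ (ι-cancel-≤ (begin
    ι (+ Z)                              ≡⟨ sym (∣ι+n∣≡ι+n Z) ⟩
    ℚ.∣ ι (+ Z) ∣                        ≤⟨ ℚP.p≤p⊔q _ _ ⟩
    polyHeight (monicQuadratic (+ Z) c₁) ≡⟨ cong polyHeight (sym minPolyα≡) ⟩
    height d α                           ≤⟨ minimal β (monicQuadratic-integral {d} {β} {+ H} {s} minPolyβ≡) genβ ⟩
    height d β                           ≡⟨ cong polyHeight minPolyβ≡ ⟩
    polyHeight (monicQuadratic (+ H) s)  ≡⟨ polyHeight-monicQuadratic (ι (+ H)) (ι s) 1≤∣ιH∣ ∣s∣≤1 ⟩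
    ℚ.∣ ι (+ H) ∣                        ≡⟨ ∣ι+n∣≡ι+n H ⟩
    ι (+ H)                              ∎))
  where
  open ℚP.≤-Reasoning
  1≤∣ιH∣ : 1ℚ ℚ.≤ ℚ.∣ ι (+ H) ∣
  1≤∣ιH∣ = subst (1ℚ ℚ.≤_) (sym (∣ι+n∣≡ι+n H)) (ι-mono-≤ (ℤ.+≤+ (ℕ.>-nonZero⁻¹ H)))

sqrt-d : QSqrt
sqrt-d = 0ℚ + 1ℚ √d

ω : QSqrt
ω = ½ + ½ √d

minPoly-sqrt-d : ∀ d → minPoly d sqrt-d ≡ x²-d d
minPoly-sqrt-d d = cong (_∷ _)
  (solve 1 (λ δ → con 0ℚ :* con 0ℚ :- δ :* con 1ℚ :* con 1ℚ := :- δ) refl (ι d))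

x²-d≡monicQuadratic : ∀ d → x²-d d ≡ monicQuadratic (ℤ.- d) (+ 0)
x²-d≡monicQuadratic d = cong (_∷ _) (sym (ι-neg d))

minPoly-ω : ∀ d → minPoly d ω ≡ x²+sx+[1-d]/4 (ℚ.- 1ℚ) d
minPoly-ω d = cong (_∷ _)
  (solve 1 (λ δ → con ½ :* con ½ :- δ :* con ½ :* con ½ := (con 1ℚ :- δ) :* con ½ :* con ½) refl (ι d))

x²+sx+[1-d]/4≡monicQuadratic : ∀ {d T} s → + 1 - d ≡ + (4 * T) →
  x²+sx+[1-d]/4 (ι s) d ≡ monicQuadratic (+ T) s
x²+sx+[1-d]/4≡monicQuadratic {d} {T} s 1-d≡4T = cong (_∷ _) (begin
  (1ℚ ℚ.- ι d) ℚ.* ½ ℚ.* ½          ≡⟨ cong (λ x → x ℚ.* ½ ℚ.* ½) (sym (ι-- (+ 1) d)) ⟩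
  ι (+ 1 - d) ℚ.* ½ ℚ.* ½           ≡⟨ cong (λ x → ι x ℚ.* ½ ℚ.* ½) 1-d≡4T ⟩
  ι (+ (4 * T)) ℚ.* ½ ℚ.* ½         ≡⟨ cong (λ x → x ℚ.* ½ ℚ.* ½) (trans (cong ι (ℤP.pos-* 4 T)) (ι-* (+ 4) (+ T))) ⟩
  ι (+ 4) ℚ.* ι (+ T) ℚ.* ½ ℚ.* ½   ≡⟨ solve 1 (λ t → con (ι (+ 4)) :* t :* con ½ :* con ½ := t) refl (ι (+ T)) ⟩
  ι (+ T)                           ∎)
  where open ≡-Reasoning

module MinimalNegative (e : ℕ) (α : QSqrt)
  (minimal : ∀ β → IsAlgInt -[1+ e ] β → Generates β → height -[1+ e ] α ℚ.≤ height -[1+ e ] β)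
  {Z c₁ f} (minPoly≡ : minPoly -[1+ e ] α ≡ monicQuadratic (+ Z) c₁) (f≢0 : f ≢ + 0)
  (normEq : ℤ.∣ c₁ ∣ * ℤ.∣ c₁ ∣ + suc e * (ℤ.∣ f ∣ * ℤ.∣ f ∣) ≡ 4 * Z)
  where

  private
    d : ℤ
    d = -[1+ e ]
    ∣f∣≢0 : ℤ.∣ f ∣ ≢ 0
    ∣f∣≢0 = f≢0 ∘ ℤP.∣i∣≡0⇒i≡0
    norm≤ : ∀ β H .{{_ : NonZero H}} s → Generates β → minPoly d β ≡ monicQuadratic (+ H) s →
      ℚ.∣ ι s ∣ ℚ.≤ 1ℚ → Z ≤ H
    norm≤ = minimal⇒norm≤ {d} {α} minimal {Z} {c₁} minPoly≡

  minPoly≡x²-d : (+ 4 ∣ d - + 2) ⊎ (+ 4 ∣ d - + 3) → minPoly d α ≡ x²-d d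
  minPoly≡x²-d 4∣d-2,3 = trans minPoly≡ (trans (cong₂ monicQuadratic (cong +_ (proj₂ a≡0∧Z≡D)) c₁≡0)
                                               (sym (x²-d≡monicQuadratic d)))
    where
    D≡2,3 : 4 ∣ₙ 2 + suc e ⊎ 4 ∣ₙ 3 + suc e
    D≡2,3 = Sum.map (subst (4 ∣ₙ_) (∣-[1+m]-+[1+n]∣ e 1)) (subst (4 ∣ₙ_) (∣-[1+m]-+[1+n]∣ e 2)) 4∣d-2,3
    a≡0∧Z≡D : ℤ.∣ c₁ ∣ ≡ 0 × Z ≡ suc e
    a≡0∧Z≡D = Z≤D⇒a≡0∧Z≡D {ℤ.∣ c₁ ∣} normEq ∣f∣≢0 D≡2,3
      (norm≤ sqrt-d (suc e) (+ 0) (λ ()) (trans (minPoly-sqrt-d d) (x²-d≡monicQuadratic d)) (ℚ.*≤* (ℤ.+≤+ z≤n)))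
    c₁≡0 : c₁ ≡ + 0
    c₁≡0 = ℤP.∣i∣≡0⇒i≡0 (proj₁ a≡0∧Z≡D)

  minPoly≡x²±x+[1-d]/4 : (+ 4 ∣ d - + 1) →
    (minPoly d α ≡ x²+sx+[1-d]/4 1ℚ d) ⊎ (minPoly d α ≡ x²+sx+[1-d]/4 (ℚ.- 1ℚ) d)
  minPoly≡x²±x+[1-d]/4 4∣d-1@(divides T d-1≡T*4) =
    Sum.map (conclude {+ 1}) (conclude { -[1+ 0 ]}) (∣i∣≡1⇒i≡±1 (proj₁ a≡1∧Z≡T))
    where
    instance
      T≢0 : NonZero T
      T≢0 = ℕD.quotient≢0 4∣d-1
    1+D≡4T : 1 + suc e ≡ 4 * T
    1+D≡4T = trans (sym (∣-[1+m]-+[1+n]∣ e 0)) (trans d-1≡T*4 (ℕP.*-comm T 4))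
    x²+sx+[1-d]/4≡monic : ∀ s → x²+sx+[1-d]/4 (ι s) d ≡ monicQuadratic (+ T) s
    x²+sx+[1-d]/4≡monic s = x²+sx+[1-d]/4≡monicQuadratic {d} {T} s (cong +_ 1+D≡4T)
    a≡1∧Z≡T : ℤ.∣ c₁ ∣ ≡ 1 × Z ≡ T
    a≡1∧Z≡T = Z≤T⇒a≡1∧Z≡T {ℤ.∣ c₁ ∣} {T = T} normEq ∣f∣≢0 1+D≡4T
      (norm≤ ω T -[1+ 0 ] (λ ()) (trans (minPoly-ω d) (x²+sx+[1-d]/4≡monic -[1+ 0 ])) ℚP.≤-refl)
    conclude : ∀ {s} → c₁ ≡ s → minPoly d α ≡ x²+sx+[1-d]/4 (ι s) d
    conclude {s} c₁≡s = trans minPoly≡ (trans (cong₂ monicQuadratic (cong +_ (proj₂ a≡1∧Z≡T)) c₁≡s)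
                                              (sym (x²+sx+[1-d]/4≡monic s)))

lemma1 : (d : ℤ) → SquareFree d → d < + 0 →
    (α : QSqrt) → IsAlgInt d α → Generates α →
    (∀ (β : QSqrt) → IsAlgInt d β → Generates β → height d α ℚ.≤ height d β) →
    (((+ 4 ∣ d - + 2) ⊎ (+ 4 ∣ d - + 3)) → minPoly d α ≡ x²-d d)
    × ((+ 4 ∣ d - + 1) →
    (minPoly d α ≡ x²+sx+[1-d]/4 1ℚ d) ⊎ (minPoly d α ≡ x²+sx+[1-d]/4 (ℚ.- 1ℚ) d))
lemma1 (+ _) _ (ℤ.+<+ ())
lemma1 d@(-[1+ e ]) sf _ α ai gen minimal with algInt⇒integralForm {d} {α} sf ai gen
... | integralForm c₀ c₁ f minPoly≡ f≢0 disc with norm-equation {e} {c₀} {c₁} {f} disc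
...   | Z , refl , normEq = minPoly≡x²-d , minPoly≡x²±x+[1-d]/4
  where open MinimalNegative e α minimal {Z} {c₁} {f} minPoly≡ f≢0 normEq
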